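{- Let $A$ be a set of ridges of the $4$-cube $C^4$ such that the union of the ridges in $A$ does not contain a pair of antipodal edges. Then $A$ contains at most four spanning ridges.
   Context: $C^4=[0,1]^4$. A $k$-face of $C^4$ is given by a word in $\{0,1,X\}^4$ with exactly $k$ letters $X$ (the set of points agreeing with the word in the non-$X$, "fixed", positions). Two $k$-faces are antipodal iff they have exactly the same fixed positions and differ in every fixed position. Ridges of $C^4$ are its $2$-faces and edges its $1$-faces. A spanning ridge is a ridge meeting both the bottom facet $XXX0$ and the top facet $XXX1$, i.e. a ridge whose word has $X$ in the last position. -}

module Defs where

open import Data.Nat using (ℕ; zero; suc)
open import Data.Vec using (Vec; []; _∷_; last)
open import Data.Vec.Relation.Binary.Pointwise.Inductive using (Pointwise)
open import Data.List using (List)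
open import Data.List.Membership.Propositional using (_∈_)
open import Data.Product using (∃; _×_)
open import Data.Sum using (_⊎_)
open import Data.Unit using (⊤)
open import Data.Empty using (⊥)
open import Relation.Binary.PropositionalEquality using (_≡_; refl)
open import Relation.Nullary using (Dec; yes; no)

-- Letters of a face word: fixed coordinate 0, fixed coordinate 1, or free X.
data Letter : Set where
  O I X : Letter

Word : Set
Word = Vec Letter 4

numX : ∀ {n} → Vec Letter n → ℕ
numX [] = zero
numX (X ∷ w) = suc (numX w)
numX (O ∷ w) = numX w
numX (I ∷ w) = numX w

IsFace : ℕ → Word → Set
IsFace k w = numX w ≡ k

IsRidge : Word → Set
IsRidge = IsFace 2

IsEdge : Word → Set
IsEdge = IsFace 1

SubL : Letter → Letter → Set
SubL a b = (a ≡ b) ⊎ (b ≡ X)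

_⊆F_ : Word → Word → Set
f ⊆F g = Pointwise SubL f g

AntiL : Letter → Letter → Set
AntiL X X = ⊤
AntiL O I = ⊤
AntiL I O = ⊤
AntiL _ _ = ⊥

Antipodal : Word → Word → Set
Antipodal f g = Pointwise AntiL f g

-- the face e is contained in the union of the faces in A
-- (for an edge and a finite set of ridges this is equivalent to e lying
-- in a single ridge of A)
InUnion : List Word → Word → Set
InUnion A e = ∃ λ r → r ∈ A × e ⊆F r

Spanning : Word → Set
Spanning w = last w ≡ X

spanning? : (w : Word) → Dec (Spanning w)
spanning? w with last w
... | X = yes refl
... | O = no λ ()
... | I = no λ ()

-- The spanning ridges of C⁴ correspond to the twelve edges of the 3-cube and the vertical
-- edges they contain to its vertices. These twelve ridges split into four triples such
-- that any two ridges of a triple contain a pair of antipodal edges. So A contains at most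
-- one spanning ridge from each triple.
module Submission where

open import Level using (Level)
open import Data.Nat using (zero; suc; _≤_; s≤s; z≤n)
import Data.Nat as ℕ
open import Data.Nat.Properties using (+-suc; module ≤-Reasoning)
open import Data.Fin using (Fin)
import Data.Fin as Fin
open import Data.Fin.Patterns using (0F; 1F; 2F; 3F)
open import Data.List using (List; []; _∷_; _++_; [_]; length; filter; map; allFin; cartesianProductWith)
open import Data.List.Properties using (length-++; length-map; length-tabulate)
open import Data.List.Relation.Unary.All using (All)
import Data.List.Relation.Unary.All as All
import Data.List.Relation.Unary.All.Properties as All
open import Data.List.Relation.Unary.Any using (Any; here; there; any?)
open import Data.List.Relation.Unary.AllPairs using ([]; _∷_)
open import Data.List.Relation.Unary.Unique.Propositional using (Unique)
import Data.List.Relation.Unary.Unique.Propositional.Properties as Unique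
open import Data.List.Membership.Propositional using (_∈_; find)
open import Data.List.Membership.Propositional.Properties
  using (∈-∃++; ∈-++⁻; ∈-++⁺ˡ; ∈-++⁺ʳ; ∈-filter⁺; ∈-filter⁻; ∈-allFin; ∈-cartesianProductWith⁺)
open import Data.List.Relation.Binary.Subset.Propositional using (_⊆_)
open import Data.Vec using (Vec; []; _∷_)
open import Data.Vec.Properties using (≡-dec)
import Data.Vec.Relation.Binary.Pointwise.Inductive as Pointwise
open import Data.Product using (_×_; _,_; proj₂)
open import Data.Sum using (inj₁; inj₂)
open import Data.Unit using (tt)
open import Data.Empty using (⊥-elim)
open import Relation.Nullary using (¬_; yes; no)
open import Relation.Nullary.Decidable using (_×-dec_; _⊎-dec_; _→-dec_; ¬?; from-yes; decidable-stable)
open import Relation.Binary.Definitions using (DecidableEquality; Decidable)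
open import Relation.Binary.PropositionalEquality using (_≡_; _≢_; refl; sym; subst)

open import Defs

private
  variable
    a b : Level
    A B : Set a

unique⊆⇒length≤ : {xs ys : List A} → Unique xs → xs ⊆ ys → length xs ≤ length ys
unique⊆⇒length≤ {xs = []} _ _ = z≤n
unique⊆⇒length≤ {xs = x ∷ xs} {ys} (x∉xs ∷ unique) xs⊆ys with ∈-∃++ (xs⊆ys (here refl))
... | ys₁ , ys₂ , refl =
  subst (suc (length xs) ≤_) (sym length-split) (s≤s (unique⊆⇒length≤ unique xs⊆ys₁++ys₂))
  where
  xs⊆ys₁++ys₂ : xs ⊆ ys₁ ++ ys₂
  xs⊆ys₁++ys₂ z∈xs with ∈-++⁻ ys₁ (xs⊆ys (there z∈xs))
  ... | inj₁ z∈ys₁ = ∈-++⁺ˡ z∈ys₁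
  ... | inj₂ (here refl) = ⊥-elim (All.lookup x∉xs z∈xs refl)
  ... | inj₂ (there z∈ys₂) = ∈-++⁺ʳ ys₁ z∈ys₂
  length-split : length (ys₁ ++ x ∷ ys₂) ≡ suc (length (ys₁ ++ ys₂))
  length-split rewrite length-++ ys₁ {x ∷ ys₂} | length-++ ys₁ {ys₂} = +-suc (length ys₁) (length ys₂)

InjectiveOn : (A → B) → List A → Set _
InjectiveOn f xs = ∀ {x y} → x ∈ xs → y ∈ xs → f x ≡ f y → x ≡ y

unique-map⁺ : {xs : List A} (f : A → B) → InjectiveOn f xs → Unique xs → Unique (map f xs)
unique-map⁺ f injective [] = []
unique-map⁺ f injective (x∉xs ∷ unique) =
  All.map⁺ (All.tabulate λ y∈xs fx≡fy → All.lookup x∉xs y∈xs (injective (here refl) (there y∈xs) fx≡fy))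
  ∷ unique-map⁺ f (λ x∈ y∈ → injective (there x∈) (there y∈)) unique

injectiveOn⇒length≤ : ∀ {n} {xs : List A} (f : A → Fin n) → InjectiveOn f xs → Unique xs → length xs ≤ n
injectiveOn⇒length≤ {n = n} {xs} f injective unique = begin
  length xs           ≡⟨ length-map f xs ⟨
  length (map f xs)   ≤⟨ unique⊆⇒length≤ (unique-map⁺ f injective unique) (λ {k} _ → ∈-allFin k) ⟩
  length (allFin n)   ≡⟨ length-tabulate (λ k → k) ⟩
  n                   ∎
  where open ≤-Reasoning

vectors : ∀ n → List A → List (Vec A n)
vectors zero xs = [ [] ]
vectors (suc n) xs = cartesianProductWith _∷_ xs (vectors n xs)

∈-vectors : {xs : List A} → (∀ x → x ∈ xs) → ∀ {n} (v : Vec A n) → v ∈ vectors n xs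
∈-vectors complete [] = here refl
∈-vectors complete (x ∷ v) = ∈-cartesianProductWith⁺ _∷_ (complete x) (∈-vectors complete v)

_≟L_ : DecidableEquality Letter
O ≟L O = yes refl
O ≟L I = no λ ()
O ≟L X = no λ ()
I ≟L O = no λ ()
I ≟L I = yes refl
I ≟L X = no λ ()
X ≟L O = no λ ()
X ≟L I = no λ ()
X ≟L X = yes refl

_≟W_ : DecidableEquality Word
_≟W_ = ≡-dec _≟L_

antiL? : Decidable AntiL
antiL? O O = no λ ()
antiL? O I = yes tt
antiL? O X = no λ ()
antiL? I O = yes tt
antiL? I I = no λ ()
antiL? I X = no λ ()
antiL? X O = no λ ()
antiL? X I = no λ ()
antiL? X X = yes tt

_⊆F?_ : Decidable _⊆F_
_⊆F?_ = Pointwise.decidable λ a b → (a ≟L b) ⊎-dec (b ≟L X)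

antipodal? : Decidable Antipodal
antipodal? = Pointwise.decidable antiL?

words : List Word
words = vectors 4 (O ∷ I ∷ X ∷ [])

∈-words : ∀ w → w ∈ words
∈-words = ∈-vectors {xs = O ∷ I ∷ X ∷ []}
  λ { O → here refl ; I → there (here refl) ; X → there (there (here refl)) }

edges : List Word
edges = filter (λ w → numX w ℕ.≟ 1) words

spanningRidges : List Word
spanningRidges = filter (λ w → (numX w ℕ.≟ 2) ×-dec spanning? w) words

∈-spanningRidges : ∀ {r} → IsRidge r → Spanning r → r ∈ spanningRidges
∈-spanningRidges {r} ridge spanning =
  ∈-filter⁺ (λ w → (numX w ℕ.≟ 2) ×-dec spanning? w) {xs = words} (∈-words r) (ridge , spanning)

∈-edges⇒IsEdge : ∀ {e} → e ∈ edges → IsEdge e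
∈-edges⇒IsEdge e∈ = proj₂ (∈-filter⁻ (λ w → numX w ℕ.≟ 1) {xs = words} e∈)

HaveAntipodalEdges : Word → Word → Set
HaveAntipodalEdges r s = Any (λ e → Any (λ f → Antipodal e f × e ⊆F r × f ⊆F s) edges) edges

haveAntipodalEdges? : Decidable HaveAntipodalEdges
haveAntipodalEdges? r s = any? (λ e → any? (λ f → antipodal? e f ×-dec e ⊆F? r ×-dec f ⊆F? s) edges) edges

-- The four triples; words that are not spanning ridges get an arbitrary class.
ridgeClass : Word → Fin 4
ridgeClass (X ∷ O ∷ O ∷ X ∷ []) = 0F
ridgeClass (O ∷ X ∷ I ∷ X ∷ []) = 0F
ridgeClass (I ∷ I ∷ X ∷ X ∷ []) = 0F
ridgeClass (X ∷ I ∷ I ∷ X ∷ []) = 1F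
ridgeClass (O ∷ X ∷ O ∷ X ∷ []) = 1F
ridgeClass (I ∷ O ∷ X ∷ X ∷ []) = 1F
ridgeClass (X ∷ I ∷ O ∷ X ∷ []) = 2F
ridgeClass (I ∷ X ∷ I ∷ X ∷ []) = 2F
ridgeClass (O ∷ O ∷ X ∷ X ∷ []) = 2F
ridgeClass (X ∷ O ∷ I ∷ X ∷ []) = 3F
ridgeClass (I ∷ X ∷ O ∷ X ∷ []) = 3F
ridgeClass (O ∷ I ∷ X ∷ X ∷ []) = 3F
ridgeClass _ = 0F

sameRidgeClass⇒antipodalEdges :
  All (λ r → All (λ s → ridgeClass r ≡ ridgeClass s → r ≢ s → HaveAntipodalEdges r s) spanningRidges)
      spanningRidges
sameRidgeClass⇒antipodalEdges = from-yes (All.all? (λ r → All.all? (λ s →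
  (ridgeClass r Fin.≟ ridgeClass s) →-dec ¬? (r ≟W s) →-dec haveAntipodalEdges? r s) spanningRidges) spanningRidges)

lemma5 : (A : List Word) → Unique A → All IsRidge A →
    (∀ e f → IsEdge e → IsEdge f → Antipodal e f → ¬ (InUnion A e × InUnion A f)) →
    length (filter spanning? A) ≤ 4
lemma5 A unique ridges antipodal-free =
  injectiveOn⇒length≤ ridgeClass ridgeClass-injective (Unique.filter⁺ spanning? unique)
  where
  spanningRidge : ∀ {r} → r ∈ filter spanning? A → r ∈ A × r ∈ spanningRidges
  spanningRidge r∈ with ∈-filter⁻ spanning? r∈
  ... | r∈A , spanning = r∈A , ∈-spanningRidges (All.lookup ridges r∈A) spanning

  ridgeClass-injective : InjectiveOn ridgeClass (filter spanning? A)
  ridgeClass-injective {r} {s} r∈ s∈ same-class = decidable-stable (r ≟W s) λ r≢s →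
    let r∈A , r-spanning = spanningRidge r∈
        s∈A , s-spanning = spanningRidge s∈
        conflict = All.lookup (All.lookup sameRidgeClass⇒antipodalEdges r-spanning) s-spanning same-class r≢s
        e , e∈edges , any-f = find conflict
        f , f∈edges , antipodal , e⊆r , f⊆s = find any-f
    in antipodal-free e f (∈-edges⇒IsEdge e∈edges) (∈-edges⇒IsEdge f∈edges) antipodal
         ((r , r∈A , e⊆r) , (s , s∈A , f⊆s))
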